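{- Let $R=\{(0,0),(0,1),(1,0),(1,1)\}\subseteq\{0,1,2\}^2$. Then the mesh patterns $(12,R)$ and $(21,R)$ are equidistributed: $(12,R)\sim_d(21,R)$.
   Context: $S_n$ denotes the set of permutations of $[n]=\{1,\dots,n\}$, written $\pi=\pi_1\cdots\pi_n$. A mesh pattern of length $k$ is a pair $(\tau,R)$ with $\tau\in S_k$ and $R\subseteq\{0,1,\dots,k\}^2$ (the shaded boxes; box $(a,b)$ is the unit square $[a,a+1]\times[b,b+1]$ in the diagram of $\tau$). An occurrence of $(\tau,R)$ in $\pi\in S_n$ is a choice of indices $i_1<\dots<i_k$ such that $\pi_{i_1}\cdots\pi_{i_k}$ is order-isomorphic to $\tau$ and, with $i_0=0$, $i_{k+1}=n+1$, $v_1<\dots<v_k$ the values $\pi_{i_1},\dots,\pi_{i_k}$ sorted increasingly, $v_0=0$, $v_{k+1}=n+1$, for every $(a,b)\in R$ there is no index $m$ with $i_a<m<i_{a+1}$ and $v_b<\pi_m<v_{b+1}$. Mesh patterns $p,q$ are equidistributed, $p\sim_d q$, if for all $n,\ell\ge0$ the number of $\pi\in S_n$ with exactly $\ell$ occurrences of $p$ equals the number with exactly $\ell$ occurrences of $q$. -}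

module Defs where

open import Data.Nat using (ℕ; zero; suc; _+_; _<ᵇ_; _≤ᵇ_; _≡ᵇ_)
open import Data.Fin using (Fin; toℕ)
open import Data.Vec using (Vec; []; _∷_; lookup; toList)
open import Data.List.Base using (List; []; _∷_; map; concatMap; filterᵇ; length; allFin)
open import Data.Bool.ListAction using (and)
open import Data.Bool using (Bool; true; false; _∧_; _∨_; not; if_then_else_)
open import Data.Product using (_×_; _,_)

-- A permutation π ∈ S_n is represented 0-based as a vector of length n over Fin n
-- (entry at position m is π_{m+1} - 1), required to be injective.
-- A mesh pattern of length k: τ ∈ S_k (same representation) and the set R of
-- shaded boxes, given as a list of pairs (a , b) with a , b ∈ {0,…,k}.
record MeshPattern : Set where
  constructor mesh
  field
    len   : ℕ
    τ     : Vec (Fin len) len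
    boxes : List (Fin (suc len) × Fin (suc len))

all : {A : Set} → (A → Bool) → List A → Bool
all p xs = and (map p xs)

_⇔ᵇ_ : Bool → Bool → Bool
true  ⇔ᵇ b = b
false ⇔ᵇ b = not b

vecs : (n k : ℕ) → List (Vec (Fin n) k)
vecs n zero    = [] ∷ []
vecs n (suc k) = concatMap (λ x → map (x ∷_) (vecs n k)) (allFin n)

isInjective : {n k : ℕ} → Vec (Fin n) k → Bool
isInjective {k = k} v =
  all (λ a → all (λ b → (toℕ a ≡ᵇ toℕ b) ∨ not (toℕ (lookup v a) ≡ᵇ toℕ (lookup v b))) (allFin k)) (allFin k)

perms : (n : ℕ) → List (Vec (Fin n) n)
perms n = filterᵇ isInjective (vecs n n)

increasingL : List ℕ → Bool
increasingL []           = true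
increasingL (x ∷ [])     = true
increasingL (x ∷ y ∷ xs) = (x <ᵇ y) ∧ increasingL (y ∷ xs)

incTuples : (n k : ℕ) → List (Vec (Fin n) k)
incTuples n k = filterᵇ (λ v → increasingL (map toℕ (toList v))) (vecs n k)

insertℕ : ℕ → List ℕ → List ℕ
insertℕ x []       = x ∷ []
insertℕ x (y ∷ ys) = if x ≤ᵇ y then x ∷ y ∷ ys else y ∷ insertℕ x ys

sortℕ : List ℕ → List ℕ
sortℕ []       = []
sortℕ (x ∷ xs) = insertℕ x (sortℕ xs)

extTail : ℕ → List ℕ → ℕ → ℕ
extTail top []       _       = top
extTail top (x ∷ xs) zero    = x
extTail top (x ∷ xs) (suc j) = extTail top xs j

ext : ℕ → List ℕ → ℕ → ℕ
ext top xs zero    = 0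
ext top xs (suc j) = extTail top xs j

-- Is the choice of indices idx an occurrence of p in π ?  (1-based positions and
-- values are used for i_a and v_b, with i_0 = 0, i_{k+1} = n+1, v_0 = 0, v_{k+1} = n+1.)
isOccurrence : (p : MeshPattern) {n : ℕ} → Vec (Fin n) n → Vec (Fin n) (MeshPattern.len p) → Bool
isOccurrence (mesh k τ R) {n} π idx = orderIso ∧ meshOK
  where
  pos : Fin n → ℕ
  pos m = suc (toℕ m)
  val : Fin n → ℕ
  val m = suc (toℕ (lookup π m))
  orderIso : Bool
  orderIso = all (λ a → all (λ b →
      (val (lookup idx a) <ᵇ val (lookup idx b)) ⇔ᵇ (toℕ (lookup τ a) <ᵇ toℕ (lookup τ b)))
      (allFin k)) (allFin k)
  I : ℕ → ℕ
  I = ext (suc n) (map pos (toList idx))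
  V : ℕ → ℕ
  V = ext (suc n) (sortℕ (map (λ j → val j) (toList idx)))
  boxOK : Fin (suc k) × Fin (suc k) → Bool
  boxOK (a , b) = all (λ m → not (
      (I (toℕ a) <ᵇ pos m) ∧ (pos m <ᵇ I (suc (toℕ a))) ∧
      (V (toℕ b) <ᵇ val m) ∧ (val m <ᵇ V (suc (toℕ b))))) (allFin n)
  meshOK : Bool
  meshOK = all boxOK R

occurrences : (p : MeshPattern) {n : ℕ} → Vec (Fin n) n → ℕ
occurrences p {n} π = length (filterᵇ (isOccurrence p π) (incTuples n (MeshPattern.len p)))

countWith : MeshPattern → ℕ → ℕ → ℕ
countWith p n ℓ = length (filterᵇ (λ π → occurrences p π ≡ᵇ ℓ) (perms n))

infix 4 _∼d_
_∼d_ : MeshPattern → MeshPattern → Set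
p ∼d q = ∀ (n ℓ : ℕ) → countWith p n ℓ ≡ countWith q n ℓ
  where open import Relation.Binary.PropositionalEquality using (_≡_)

R₂ : List (Fin 3 × Fin 3)
R₂ = (Fin.zero , Fin.zero) ∷ (Fin.zero , Fin.suc Fin.zero) ∷
     (Fin.suc Fin.zero , Fin.zero) ∷ (Fin.suc Fin.zero , Fin.suc Fin.zero) ∷ []
  where import Data.Fin as Fin

p12 : MeshPattern
p12 = mesh 2 (Fin.zero ∷ Fin.suc Fin.zero ∷ []) R₂
  where import Data.Fin as Fin

p21 : MeshPattern
p21 = mesh 2 (Fin.suc Fin.zero ∷ Fin.zero ∷ []) R₂
  where import Data.Fin as Fin

-- Both patterns constrain only the entries to the left of the second point b: an occurrence
-- at a < b needs every other entry left of b to lie above the higher of the two points.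
-- Hence (12,R) ends at b exactly when π_b is the second smallest of π_1 … π_b, and (21,R)
-- exactly when π_b is the smallest of them and b ≥ 2; in both cases a is then forced.
-- Build π by appending entries, recording the rank r of each new entry among the entries so
-- far: the new entry adds [r = 1] occurrences of (12,R) and [r = 0, b ≥ 2] of (21,R).
-- Exchanging the ranks 0 and 1 at every step is an involution of S_n that turns the first
-- count into the second, so the two statistics are equidistributed.
module Submission where

open import Defs
open import Data.Bool using (Bool; true; false; T; T?; not; _∧_; _∨_)
open import Data.Bool.Properties using (T-∧; T-∨; T-≡; T-not-≡)
open import Data.Empty using (⊥-elim)
open import Data.Fin using (Fin; zero; suc; toℕ; inject₁; fromℕ; punchIn; punchOut; _≟_; _<_; _≤_)
open import Data.Fin.Properties
  using ( toℕ-injective; toℕ-inject₁; toℕ-fromℕ; toℕ<n; inject₁ℕ<; inject₁-injective; fromℕ≢inject₁; ≤fromℕ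
        ; <-cmp; _<?_; <-trans; <⇒≢; ≤∧≢⇒<; any?; injective⇒≤
        ; punchIn-injective; punchInᵢ≢i; punchIn-mono-≤; punchIn-cancel-≤
        ; punchOut-injective; punchOut-cong; punchOut-punchIn; punchIn-punchOut )
open import Data.Fin.Relation.Unary.Top using (View; view; ‵fromℕ; ‵inj₁)
open import Data.List.Base using (List; []; _∷_; _++_; map; length; filterᵇ; allFin; cartesianProductWith; concatMap)
open import Data.List.Properties using (length-++; filter-++; filter-none)
open import Data.List.Membership.Propositional using (_∈_)
open import Data.List.Membership.Propositional.Properties
  using (∈-filter⁺; ∈-filter⁻; ∈-map⁺; ∈-map⁻; ∈-++⁺ˡ; ∈-++⁺ʳ; ∈-++⁻; ∈-allFin; ∈-cartesianProductWith⁺)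
open import Data.List.Membership.Propositional.Properties.WithK using (unique∧set⇒bag)
open import Data.List.Relation.Binary.BagAndSetEquality using (∼bag⇒↭)
open import Data.List.Relation.Binary.Permutation.Propositional using (_↭_)
open import Data.List.Relation.Binary.Permutation.Propositional.Properties using (↭-length; filter-↭)
import Data.List.Relation.Unary.All as All
import Data.List.Relation.Unary.All.Properties as All
open import Data.List.Relation.Unary.AllPairs using ([]; _∷_)
open import Data.List.Relation.Unary.Any using (here; there)
open import Data.List.Relation.Unary.Unique.Propositional using (Unique)
import Data.List.Relation.Unary.Unique.Propositional.Properties as Unique
open import Data.Nat using (ℕ; zero; suc; _+_; z≤n; s≤s; _<ᵇ_; _≡ᵇ_)
import Data.Nat as ℕ
open import Data.Nat.Properties
  using ( <ᵇ⇒<; <⇒<ᵇ; ≡ᵇ⇒≡; ≡⇒≡ᵇ; ≰⇒>; ≮⇒≥; <⇒≱; <⇒≤; ≤-refl; ≤-trans; n≮n; n≮0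
        ; n<1⇒n≡0; n≤0⇒n≡0; n≢0⇒n>0; m<n⇒m<1+n; 1+n≰n )
open import Data.Product using (_×_; _,_; proj₁; proj₂; ∃)
import Data.Product as Product
open import Data.Sum using (_⊎_; inj₁; inj₂; [_,_]′)
import Data.Sum as Sum
open import Data.Vec using (Vec; []; _∷_; lookup; tabulate; _∷ʳ_)
import Data.Vec as V
open import Data.Vec.Properties
  using (∷-injectiveˡ; ∷-injectiveʳ; lookup-map; lookup∘tabulate; tabulate∘lookup; tabulate-cong)
open import Function using (_∘_; _⇔_; mk⇔; Equivalence; Injective)
import Function.Properties.Equivalence as ⇔
open import Relation.Binary.Definitions using (tri<; tri≈; tri>)
open import Relation.Binary.PropositionalEquality
open import Relation.Nullary using (¬_; yes; no; contradiction)

open Equivalence using (to; from)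

private
  variable
    A B C : Set
    n k : ℕ

T-not : ∀ {x} → T (not x) ⇔ (¬ T x)
T-not {true}  = mk⇔ (λ ()) (λ ¬t → ¬t _)
T-not {false} = mk⇔ (λ _ ()) (λ _ → _)

T-∧⁴ : ∀ {w x y z} → T (w ∧ (x ∧ (y ∧ (z ∧ true)))) ⇔ (T w × T x × T y × T z)
T-∧⁴ {true}  {true}  {true}  {true}  = mk⇔ _ _
T-∧⁴ {true}  {true}  {true}  {false} = mk⇔ (λ ()) (λ ())
T-∧⁴ {true}  {true}  {false}         = mk⇔ (λ ()) (λ ())
T-∧⁴ {true}  {false}                 = mk⇔ (λ ()) (λ ())
T-∧⁴ {false}                         = mk⇔ (λ ()) (λ ())

T-injective : ∀ {x y} → (T x ⇔ T y) → x ≡ y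
T-injective {true}  {true}  _   = refl
T-injective {true}  {false} x⇔y = ⊥-elim (to x⇔y _)
T-injective {false} {true}  x⇔y = ⊥-elim (from x⇔y _)
T-injective {false} {false} _   = refl

T-<ᵇ : ∀ {m n} → T (m <ᵇ n) ⇔ m ℕ.< n
T-<ᵇ = mk⇔ (<ᵇ⇒< _ _) <⇒<ᵇ

<ᵇ-true : ∀ {m n} → m ℕ.< n → (m <ᵇ n) ≡ true
<ᵇ-true = to T-≡ ∘ <⇒<ᵇ

<ᵇ-false : ∀ {m n} → ¬ m ℕ.< n → (m <ᵇ n) ≡ false
<ᵇ-false m≮n = to T-not-≡ (from T-not (m≮n ∘ <ᵇ⇒< _ _))

T-all-allFin : (p : Fin n → Bool) → T (all p (allFin n)) ⇔ (∀ i → T (p i))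
T-all-allFin p = mk⇔ (All.tabulate⁻ ∘ All.all⁺ p _) (All.all⁻ p ∘ All.tabulate⁺)

unique∧set⇒↭ : {xs ys : List A} → Unique xs → Unique ys → (∀ {x} → x ∈ xs ⇔ x ∈ ys) → xs ↭ ys
unique∧set⇒↭ xs! ys! xs≈ys = ∼bag⇒↭ (unique∧set⇒bag xs! ys! xs≈ys)

length-filterᵇ-↭ : (p : A → Bool) {xs ys : List A} → xs ↭ ys → length (filterᵇ p xs) ≡ length (filterᵇ p ys)
length-filterᵇ-↭ p = ↭-length ∘ filter-↭ (T? ∘ p)

length-filterᵇ-map : (p : B → Bool) (f : A → B) (xs : List A) →
  length (filterᵇ p (map f xs)) ≡ length (filterᵇ (p ∘ f) xs)
length-filterᵇ-map p f []       = refl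
length-filterᵇ-map p f (x ∷ xs) with p (f x)
... | true  = cong suc (length-filterᵇ-map p f xs)
... | false = length-filterᵇ-map p f xs

filterᵇ-cong-∈ : {p q : A → Bool} (xs : List A) → (∀ {x} → x ∈ xs → p x ≡ q x) → filterᵇ p xs ≡ filterᵇ q xs
filterᵇ-cong-∈                 []       _   = refl
filterᵇ-cong-∈ {p = p} {q} (x ∷ xs) p≗q with p x | q x | p≗q (here refl)
... | true  | true  | _ = cong (x ∷_) (filterᵇ-cong-∈ xs (p≗q ∘ there))
... | false | false | _ = filterᵇ-cong-∈ xs (p≗q ∘ there)

unique-map⁺-on : {xs : List A} {f : A → B} → (∀ {x y} → x ∈ xs → y ∈ xs → f x ≡ f y → x ≡ y) →
  Unique xs → Unique (map f xs)
unique-map⁺-on f-inj []            = []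
unique-map⁺-on f-inj (x≢xs ∷ xs!) =
  All.map⁺ (All.tabulate λ y∈xs fx≡fy → All.lookup x≢xs y∈xs (f-inj (here refl) (there y∈xs) fx≡fy))
  ∷ unique-map⁺-on (λ x∈ y∈ → f-inj (there x∈) (there y∈)) xs!

module _ {f : A → A} {xs : List A} (xs! : Unique xs)
         (f-closed : ∀ {x} → x ∈ xs → f x ∈ xs) (f-involutive : ∀ {x} → x ∈ xs → f (f x) ≡ x) where

  map-involution-↭ : map f xs ↭ xs
  map-involution-↭ = unique∧set⇒↭ (unique-map⁺-on f-injective xs!) xs! (mk⇔ to′ from′)
    where
    f-injective : ∀ {x y} → x ∈ xs → y ∈ xs → f x ≡ f y → x ≡ y
    f-injective x∈ y∈ fx≡fy = trans (sym (f-involutive x∈)) (trans (cong f fx≡fy) (f-involutive y∈))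
    to′ : ∀ {x} → x ∈ map f xs → x ∈ xs
    to′ x∈ with y , y∈ , refl ← ∈-map⁻ f x∈ = f-closed y∈
    from′ : ∀ {x} → x ∈ xs → x ∈ map f xs
    from′ x∈ = subst (_∈ map f xs) (f-involutive x∈) (∈-map⁺ f (f-closed x∈))

  length-filterᵇ-involution : (p q : A → Bool) → (∀ {x} → x ∈ xs → q (f x) ≡ p x) →
    length (filterᵇ p xs) ≡ length (filterᵇ q xs)
  length-filterᵇ-involution p q q∘f≗p = begin
    length (filterᵇ p xs)         ≡⟨ cong length (filterᵇ-cong-∈ xs (sym ∘ q∘f≗p)) ⟩
    length (filterᵇ (q ∘ f) xs)   ≡⟨ length-filterᵇ-map q f xs ⟨
    length (filterᵇ q (map f xs)) ≡⟨ length-filterᵇ-↭ q map-involution-↭ ⟩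
    length (filterᵇ q xs)         ∎
    where open ≡-Reasoning

length-filterᵇ-singleton : (p : A → Bool) {xs : List A} {a : A} → Unique xs → a ∈ xs → T (p a) →
  (∀ {x} → T (p x) → x ≡ a) → length (filterᵇ p xs) ≡ 1
length-filterᵇ-singleton p {xs} {a} xs! a∈xs pa unique =
  ↭-length (unique∧set⇒↭ (Unique.filter⁺ (T? ∘ p) xs!) (All.[] ∷ []) (mk⇔ to′ from′))
  where
  to′ : ∀ {x} → x ∈ filterᵇ p xs → x ∈ a ∷ []
  to′ x∈ = here (unique (proj₂ (∈-filter⁻ (T? ∘ p) {xs = xs} x∈)))
  from′ : ∀ {x} → x ∈ a ∷ [] → x ∈ filterᵇ p xs
  from′ (here refl) = ∈-filter⁺ (T? ∘ p) a∈xs pa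

length-filterᵇ-none : (p : A → Bool) (xs : List A) → (∀ x → ¬ T (p x)) → length (filterᵇ p xs) ≡ 0
length-filterᵇ-none p xs ¬p = cong length (filter-none (T? ∘ p) (All.universal ¬p xs))

concatMap-map≡cartesianProductWith : (f : A → B → C) (xs : List A) (ys : List B) →
  concatMap (λ x → map (f x) ys) xs ≡ cartesianProductWith f xs ys
concatMap-map≡cartesianProductWith f []       ys = refl
concatMap-map≡cartesianProductWith f (x ∷ xs) ys = cong (map (f x) ys ++_) (concatMap-map≡cartesianProductWith f xs ys)

vecs-unique : ∀ n k → Unique (vecs n k)
vecs-unique n zero    = All.[] ∷ []
vecs-unique n (suc k) = subst Unique (sym (concatMap-map≡cartesianProductWith _∷_ (allFin n) (vecs n k)))
  (Unique.cartesianProductWith⁺ _∷_ (λ e → ∷-injectiveˡ e , ∷-injectiveʳ e) (Unique.allFin⁺ n) (vecs-unique n k))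

∈-vecs : (v : Vec (Fin n) k) → v ∈ vecs n k
∈-vecs                 []      = here refl
∈-vecs {n} {suc k} (x ∷ v) = subst (x ∷ v ∈_) (sym (concatMap-map≡cartesianProductWith _∷_ (allFin n) (vecs n k)))
  (∈-cartesianProductWith⁺ _∷_ (∈-allFin x) (∈-vecs v))

IsPermutation : Vec (Fin n) n → Set
IsPermutation π = Injective _≡_ _≡_ (lookup π)

T-isInjective : (v : Vec (Fin n) k) → T (isInjective v) ⇔ Injective _≡_ _≡_ (lookup v)
T-isInjective {k = k} v = mk⇔ to′ from′
  where
  test : Fin k → Fin k → Bool
  test i j = (toℕ i ≡ᵇ toℕ j) ∨ not (toℕ (lookup v i) ≡ᵇ toℕ (lookup v j))
  tests : ∀ i → T (all (test i) (allFin k)) ⇔ (∀ j → T (test i j))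
  tests i = T-all-allFin (test i)
  to′ : T (isInjective v) → Injective _≡_ _≡_ (lookup v)
  to′ t {i} {j} vi≡vj with to T-∨ (to (tests i) (to (T-all-allFin (λ i → all (test i) (allFin k))) t i) j)
  ... | inj₁ i≡ᵇj  = toℕ-injective (≡ᵇ⇒≡ _ _ i≡ᵇj)
  ... | inj₂ vi≢vj = ⊥-elim (to T-not vi≢vj (≡⇒≡ᵇ _ _ (cong toℕ vi≡vj)))
  test-injective : Injective _≡_ _≡_ (lookup v) →
    ∀ i j → T (toℕ i ≡ᵇ toℕ j) ⊎ T (not (toℕ (lookup v i) ≡ᵇ toℕ (lookup v j)))
  test-injective v-inj i j with i ≟ j
  ... | yes refl = inj₁ (≡⇒≡ᵇ (toℕ i) _ refl)
  ... | no i≢j   = inj₂ (from T-not (i≢j ∘ v-inj ∘ toℕ-injective ∘ ≡ᵇ⇒≡ _ _))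
  from′ : Injective _≡_ _≡_ (lookup v) → T (isInjective v)
  from′ v-inj = from (T-all-allFin (λ i → all (test i) (allFin k))) λ i →
    from (tests i) λ j → from T-∨ (test-injective v-inj i j)

∈-perms : {π : Vec (Fin n) n} → π ∈ perms n ⇔ IsPermutation π
∈-perms {n} {π} = mk⇔
  (to (T-isInjective π) ∘ proj₂ ∘ ∈-filter⁻ (T? ∘ isInjective) {xs = vecs n n})
  (∈-filter⁺ (T? ∘ isInjective) (∈-vecs π) ∘ from (T-isInjective π))

perms-unique : ∀ n → Unique (perms n)
perms-unique n = Unique.filter⁺ (T? ∘ isInjective) (vecs-unique n n)

isIncreasing : Vec (Fin n) k → Bool
isIncreasing v = increasingL (map toℕ (V.toList v))

∈-incTuples₂ : {a b : Fin n} → (a ∷ b ∷ []) ∈ incTuples n 2 ⇔ a < b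
∈-incTuples₂ {n} {a} {b} = mk⇔
  (<ᵇ⇒< _ _ ∘ proj₁ ∘ to (T-∧ {toℕ a <ᵇ toℕ b}) ∘ proj₂ ∘ ∈-filter⁻ (T? ∘ isIncreasing) {xs = vecs n 2})
  (λ a<b → ∈-filter⁺ (T? ∘ isIncreasing) (∈-vecs (a ∷ b ∷ [])) (from T-∧ (<⇒<ᵇ a<b , _)))

map-injective : {f : A → B} → Injective _≡_ _≡_ f → Injective _≡_ _≡_ (V.map {n = k} f)
map-injective f-inj {[]}     {[]}     _ = refl
map-injective f-inj {x ∷ xs} {y ∷ ys} e = cong₂ _∷_ (f-inj (∷-injectiveˡ e)) (map-injective f-inj (∷-injectiveʳ e))

inject₁-mono-< : {a b : Fin n} → a < b → inject₁ a < inject₁ b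
inject₁-mono-< {a = a} {b} = subst₂ ℕ._<_ (sym (toℕ-inject₁ a)) (sym (toℕ-inject₁ b))

inject₁<fromℕ : (a : Fin n) → inject₁ a < fromℕ n
inject₁<fromℕ {n} a = subst (toℕ (inject₁ a) ℕ.<_) (sym (toℕ-fromℕ n)) (inject₁ℕ< a)

pairEndingAtLast : Fin n → Vec (Fin (suc n)) 2
pairEndingAtLast {n} a = inject₁ a ∷ fromℕ n ∷ []

incTuples₂-suc : incTuples (suc n) 2 ↭ map (V.map inject₁) (incTuples n 2) ++ map pairEndingAtLast (allFin n)
incTuples₂-suc {n} = unique∧set⇒↭ (Unique.filter⁺ (T? ∘ isIncreasing) (vecs-unique (suc n) 2))
  (Unique.++⁺ (Unique.map⁺ (map-injective inject₁-injective) (Unique.filter⁺ (T? ∘ isIncreasing) (vecs-unique n 2)))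
              (Unique.map⁺ (inject₁-injective ∘ ∷-injectiveˡ) (Unique.allFin⁺ n))
              disjoint)
  (mk⇔ to′ from′)
  where
  disjoint : ∀ {v} → ¬ (v ∈ map (V.map inject₁) (incTuples n 2) × v ∈ map pairEndingAtLast (allFin n))
  disjoint (v∈ˡ , v∈ʳ) with ∈-map⁻ (V.map inject₁) v∈ˡ | ∈-map⁻ pairEndingAtLast v∈ʳ
  ... | (_ ∷ b ∷ []) , _ , refl | _ , _ , e = fromℕ≢inject₁ (sym (∷-injectiveˡ (∷-injectiveʳ e)))
  to′ : ∀ {v} → v ∈ incTuples (suc n) 2 → v ∈ map (V.map inject₁) (incTuples n 2) ++ map pairEndingAtLast (allFin n)
  to′ {a ∷ b ∷ []} v∈ with to ∈-incTuples₂ v∈ | view a | view b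
  ... | a<b | ‵fromℕ           | _                = ⊥-elim (<⇒≱ a<b (≤fromℕ b))
  ... | _   | ‵inj₁ {i = a′} _ | ‵fromℕ           = ∈-++⁺ʳ _ (∈-map⁺ pairEndingAtLast (∈-allFin a′))
  ... | a<b | ‵inj₁ {i = a′} _ | ‵inj₁ {i = b′} _ =
    ∈-++⁺ˡ (∈-map⁺ (V.map inject₁) (from ∈-incTuples₂ (subst₂ ℕ._<_ (toℕ-inject₁ a′) (toℕ-inject₁ b′) a<b)))
  from′ : ∀ {v} → v ∈ map (V.map inject₁) (incTuples n 2) ++ map pairEndingAtLast (allFin n) → v ∈ incTuples (suc n) 2
  from′ v∈ with ∈-++⁻ (map (V.map inject₁) (incTuples n 2)) v∈
  ... | inj₁ v∈ˡ with ∈-map⁻ (V.map inject₁) v∈ˡ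
  ...   | (a ∷ b ∷ []) , w∈ , refl = from ∈-incTuples₂ (inject₁-mono-< (to ∈-incTuples₂ w∈))
  from′ v∈ | inj₂ v∈ʳ with ∈-map⁻ pairEndingAtLast v∈ʳ
  ...   | a , _ , refl = from ∈-incTuples₂ (inject₁<fromℕ a)

countEndingAtLast : (Vec (Fin (suc n)) 2 → Bool) → ℕ
countEndingAtLast {n} occ = length (filterᵇ (occ ∘ pairEndingAtLast) (allFin n))

count-incTuples₂-suc : (occ : Vec (Fin (suc n)) 2 → Bool) →
  length (filterᵇ occ (incTuples (suc n) 2))
    ≡ length (filterᵇ (occ ∘ V.map inject₁) (incTuples n 2)) + countEndingAtLast occ
count-incTuples₂-suc {n} occ = begin
  length (filterᵇ occ (incTuples (suc n) 2))
    ≡⟨ length-filterᵇ-↭ occ incTuples₂-suc ⟩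
  length (filterᵇ occ (old ++ new))
    ≡⟨ cong length (filter-++ (T? ∘ occ) old new) ⟩
  length (filterᵇ occ old ++ filterᵇ occ new)
    ≡⟨ length-++ (filterᵇ occ old) ⟩
  length (filterᵇ occ old) + length (filterᵇ occ new)
    ≡⟨ cong₂ _+_ (length-filterᵇ-map occ (V.map inject₁) (incTuples n 2))
                 (length-filterᵇ-map occ pairEndingAtLast (allFin n)) ⟩
  length (filterᵇ (occ ∘ V.map inject₁) (incTuples n 2)) + countEndingAtLast occ ∎
  where
  open ≡-Reasoning
  old new : List (Vec (Fin (suc n)) 2)
  old = map (V.map inject₁) (incTuples n 2)
  new = map pairEndingAtLast (allFin n)

injective⇒surjective : {f : Fin n → Fin n} → Injective _≡_ _≡_ f → ∀ y → ∃ λ x → f x ≡ y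
injective⇒surjective {suc n} {f} f-injective y with any? (λ x → f x ≟ y)
... | yes found = found
... | no ¬found = contradiction (injective⇒≤ g-injective) 1+n≰n
  where
  y≢f : ∀ x → y ≢ f x
  y≢f x y≡fx = ¬found (x , sym y≡fx)
  g : Fin (suc n) → Fin n
  g x = punchOut (y≢f x)
  g-injective : Injective _≡_ _≡_ g
  g-injective gx≡gx′ = f-injective (punchOut-injective (y≢f _) (y≢f _) gx≡gx′)

module _ {f : Fin n → Fin n} (f-injective : Injective _≡_ _≡_ f) where

  preimage : Fin n → Fin n
  preimage = proj₁ ∘ injective⇒surjective f-injective

  preimage-correct : ∀ y → f (preimage y) ≡ y
  preimage-correct = proj₂ ∘ injective⇒surjective f-injective

minimal⇒zero : {f : Fin (suc n) → Fin (suc n)} → Injective _≡_ _≡_ f →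
  ∀ a → (∀ m → m ≢ a → f a ≤ f m) → f a ≡ zero
minimal⇒zero {f = f} f-injective a minimal with preimage f-injective zero ≟ a
... | yes refl = preimage-correct f-injective zero
... | no a₀≢a  = toℕ-injective (n≤0⇒n≡0
  (subst (λ v → toℕ (f a) ℕ.≤ toℕ v) (preimage-correct f-injective zero) (minimal _ a₀≢a)))

punchIn-mono-< : ∀ (r : Fin (suc n)) {x y} → x < y → punchIn r x < punchIn r y
punchIn-mono-< r {x} {y} x<y = ≰⇒> (<⇒≱ x<y ∘ punchIn-cancel-≤ r y x)

punchIn-cancel-< : ∀ (r : Fin (suc n)) {x y} → punchIn r x < punchIn r y → x < y
punchIn-cancel-< r {x} {y} r↑x<r↑y = ≰⇒> (<⇒≱ r↑x<r↑y ∘ punchIn-mono-≤ r y x)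

≤punchIn⇔≤ : ∀ (r : Fin (suc n)) x → r ≤ punchIn r x ⇔ r ≤ x
≤punchIn⇔≤ zero    x       = mk⇔ (λ _ → z≤n) (λ _ → z≤n)
≤punchIn⇔≤ (suc r) zero    = mk⇔ (λ ()) (λ ())
≤punchIn⇔≤ (suc r) (suc x) = mk⇔ (s≤s ∘ to (≤punchIn⇔≤ r x) ∘ ℕ.s≤s⁻¹) (s≤s ∘ from (≤punchIn⇔≤ r x) ∘ ℕ.s≤s⁻¹)

punchIn<⇔< : ∀ (r : Fin (suc n)) x → punchIn r x < r ⇔ x < r
punchIn<⇔< r x = mk⇔
  (λ r↑x<r → ≰⇒> (<⇒≱ r↑x<r ∘ from (≤punchIn⇔≤ r x)))
  (λ x<r → ≰⇒> (<⇒≱ x<r ∘ to (≤punchIn⇔≤ r x)))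

<punchIn⇔≤ : ∀ (r : Fin (suc n)) x → r < punchIn r x ⇔ r ≤ x
<punchIn⇔≤ r x = mk⇔ (to (≤punchIn⇔≤ r x) ∘ <⇒≤) (λ r≤x → ≤∧≢⇒< (from (≤punchIn⇔≤ r x) r≤x) (punchInᵢ≢i r x ∘ sym))

-- A total punchOut: the value at x ≡ r is junk.
removeValue : Fin (suc (suc n)) → Fin (suc (suc n)) → Fin (suc n)
removeValue r x with r ≟ x
... | yes _  = zero
... | no r≢x = punchOut r≢x

removeValue-punchIn : ∀ (r : Fin (suc (suc n))) x → removeValue r (punchIn r x) ≡ x
removeValue-punchIn r x with r ≟ punchIn r x
... | yes r≡r↑x = ⊥-elim (punchInᵢ≢i r x (sym r≡r↑x))
... | no _      = trans (punchOut-cong r refl) (punchOut-punchIn r)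

punchIn-removeValue : ∀ {r x : Fin (suc (suc n))} → r ≢ x → punchIn r (removeValue r x) ≡ x
punchIn-removeValue {r = r} {x} r≢x with r ≟ x
... | yes r≡x = ⊥-elim (r≢x r≡x)
... | no r≢x  = punchIn-punchOut r≢x

-- Building permutations by appending an entry

lookup-∷ʳ-inject₁ : (xs : Vec A n) (x : A) (i : Fin n) → lookup (xs ∷ʳ x) (inject₁ i) ≡ lookup xs i
lookup-∷ʳ-inject₁ (y ∷ xs) x zero    = refl
lookup-∷ʳ-inject₁ (y ∷ xs) x (suc i) = lookup-∷ʳ-inject₁ xs x i

lookup-∷ʳ-fromℕ : (xs : Vec A n) (x : A) → lookup (xs ∷ʳ x) (fromℕ n) ≡ x
lookup-∷ʳ-fromℕ []       x = refl
lookup-∷ʳ-fromℕ (y ∷ xs) x = lookup-∷ʳ-fromℕ xs x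

lookup-extensionality : {xs ys : Vec A n} → (∀ i → lookup xs i ≡ lookup ys i) → xs ≡ ys
lookup-extensionality {xs = xs} {ys} xs≗ys =
  trans (sym (tabulate∘lookup xs)) (trans (tabulate-cong xs≗ys) (tabulate∘lookup ys))

extend : Vec (Fin n) n → Fin (suc n) → Vec (Fin (suc n)) (suc n)
extend σ r = V.map (punchIn r) σ ∷ʳ r

lastValue : Vec (Fin (suc n)) (suc n) → Fin (suc n)
lastValue {n} π = lookup π (fromℕ n)

restrict : Vec (Fin (suc n)) (suc n) → Vec (Fin n) n
restrict {zero}  _ = []
restrict {suc n} π = tabulate (removeValue (lastValue π) ∘ lookup π ∘ inject₁)

module _ (σ : Vec (Fin n) n) (r : Fin (suc n)) where

  lookup-extend-inject₁ : ∀ i → lookup (extend σ r) (inject₁ i) ≡ punchIn r (lookup σ i)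
  lookup-extend-inject₁ i = trans (lookup-∷ʳ-inject₁ (V.map (punchIn r) σ) r i) (lookup-map i (punchIn r) σ)

  lastValue-extend : lastValue (extend σ r) ≡ r
  lastValue-extend = lookup-∷ʳ-fromℕ (V.map (punchIn r) σ) r

  extend-isPermutation : IsPermutation σ → IsPermutation (extend σ r)
  extend-isPermutation σ-perm {i} {j} e with view i | view j
  ... | ‵fromℕ | ‵fromℕ = refl
  ... | ‵fromℕ | ‵inj₁ {i = j′} _ = ⊥-elim (punchInᵢ≢i r (lookup σ j′)
    (sym (trans (sym lastValue-extend) (trans e (lookup-extend-inject₁ j′)))))
  ... | ‵inj₁ {i = i′} _ | ‵fromℕ = ⊥-elim (punchInᵢ≢i r (lookup σ i′)
    (trans (sym (lookup-extend-inject₁ i′)) (trans e lastValue-extend)))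
  ... | ‵inj₁ {i = i′} _ | ‵inj₁ {i = j′} _ = cong inject₁ (σ-perm (punchIn-injective r _ _
    (trans (sym (lookup-extend-inject₁ i′)) (trans e (lookup-extend-inject₁ j′)))))

  extend-isPermutation⁻ : IsPermutation (extend σ r) → IsPermutation σ
  extend-isPermutation⁻ π-perm {i} {j} e = inject₁-injective (π-perm (begin
    lookup (extend σ r) (inject₁ i) ≡⟨ lookup-extend-inject₁ i ⟩
    punchIn r (lookup σ i)          ≡⟨ cong (punchIn r) e ⟩
    punchIn r (lookup σ j)          ≡⟨ lookup-extend-inject₁ j ⟨
    lookup (extend σ r) (inject₁ j) ∎))
    where open ≡-Reasoning

restrict-extend : (σ : Vec (Fin n) n) (r : Fin (suc n)) → restrict (extend σ r) ≡ σ
restrict-extend {zero}  [] r = refl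
restrict-extend {suc n} σ  r = lookup-extensionality λ i → begin
  lookup (restrict (extend σ r)) i
    ≡⟨ lookup∘tabulate (removeValue (lastValue (extend σ r)) ∘ lookup (extend σ r) ∘ inject₁) i ⟩
  removeValue (lastValue (extend σ r)) (lookup (extend σ r) (inject₁ i))
    ≡⟨ cong₂ removeValue (lastValue-extend σ r) (lookup-extend-inject₁ σ r i) ⟩
  removeValue r (punchIn r (lookup σ i))
    ≡⟨ removeValue-punchIn r (lookup σ i) ⟩
  lookup σ i ∎
  where open ≡-Reasoning

extend-restrict : {π : Vec (Fin (suc n)) (suc n)} → IsPermutation π → extend (restrict π) (lastValue π) ≡ π
extend-restrict {zero}  {_ ∷ []} _      = refl
extend-restrict {suc n} {π}      π-perm = lookup-extensionality λ i → entry i (view i)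
  where
  l : Fin (suc (suc n))
  l = lastValue π
  entry : ∀ i → View i → lookup (extend (restrict π) l) i ≡ lookup π i
  entry _ ‵fromℕ            = lastValue-extend (restrict π) l
  entry _ (‵inj₁ {i = j} _) = begin
    lookup (extend (restrict π) l) (inject₁ j)
      ≡⟨ lookup-extend-inject₁ (restrict π) l j ⟩
    punchIn l (lookup (restrict π) j)
      ≡⟨ cong (punchIn l) (lookup∘tabulate (removeValue l ∘ lookup π ∘ inject₁) j) ⟩
    punchIn l (removeValue l (lookup π (inject₁ j)))
      ≡⟨ punchIn-removeValue (fromℕ≢inject₁ ∘ π-perm) ⟩
    lookup π (inject₁ j) ∎
    where open ≡-Reasoning

restrict-isPermutation : (π : Vec (Fin (suc n)) (suc n)) → IsPermutation π → IsPermutation (restrict π)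
restrict-isPermutation π π-perm =
  extend-isPermutation⁻ (restrict π) (lastValue π) (subst IsPermutation (sym (extend-restrict π-perm)) π-perm)

swap01 : Fin (suc n) → Fin (suc n)
swap01 {suc n} zero       = suc zero
swap01 {suc n} (suc zero) = zero
swap01         i          = i

swap01-involutive : (i : Fin (suc n)) → swap01 (swap01 i) ≡ i
swap01-involutive {zero}  zero          = refl
swap01-involutive {suc n} zero          = refl
swap01-involutive {suc n} (suc zero)    = refl
swap01-involutive {suc n} (suc (suc i)) = refl

rankSwap : Vec (Fin n) n → Vec (Fin n) n
rankSwap {zero}  π = []
rankSwap {suc n} π = extend (rankSwap (restrict π)) (swap01 (lastValue π))

rankSwap-extend : (σ : Vec (Fin n) n) (r : Fin (suc n)) → rankSwap (extend σ r) ≡ extend (rankSwap σ) (swap01 r)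
rankSwap-extend σ r = cong₂ (λ σ′ r′ → extend (rankSwap σ′) (swap01 r′)) (restrict-extend σ r) (lastValue-extend σ r)

rankSwap-isPermutation : (π : Vec (Fin n) n) → IsPermutation π → IsPermutation (rankSwap π)
rankSwap-isPermutation {zero}  _ _      {()}
rankSwap-isPermutation {suc n} π π-perm = extend-isPermutation (rankSwap (restrict π)) (swap01 (lastValue π))
  (rankSwap-isPermutation (restrict π) (restrict-isPermutation π π-perm))

rankSwap-involutive : {π : Vec (Fin n) n} → IsPermutation π → rankSwap (rankSwap π) ≡ π
rankSwap-involutive {zero}  {[]} _      = refl
rankSwap-involutive {suc n} {π}  π-perm = begin
  rankSwap (extend (rankSwap σ) (swap01 r))
    ≡⟨ rankSwap-extend (rankSwap σ) (swap01 r) ⟩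
  extend (rankSwap (rankSwap σ)) (swap01 (swap01 r))
    ≡⟨ cong₂ extend (rankSwap-involutive (restrict-isPermutation π π-perm)) (swap01-involutive r) ⟩
  extend σ r
    ≡⟨ extend-restrict π-perm ⟩
  π ∎
  where
  open ≡-Reasoning
  σ : Vec (Fin n) n
  σ = restrict π
  r : Fin (suc n)
  r = lastValue π

-- Occurrences of the two patterns

outside⇔ : {lo hi v : Fin k} → lo ≤ hi → (lo ≡ v ⊎ hi ≤ v) ⇔ (¬ v < lo × ¬ (lo < v × v < hi))
outside⇔ {lo = lo} {hi} {v} lo≤hi = mk⇔ to′ from′
  where
  to′ : lo ≡ v ⊎ hi ≤ v → ¬ v < lo × ¬ (lo < v × v < hi)
  to′ (inj₁ refl) = n≮n _ , n≮n _ ∘ proj₁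
  to′ (inj₂ hi≤v) = (λ v<lo → <⇒≱ v<lo (≤-trans lo≤hi hi≤v)) , (λ (_ , v<hi) → <⇒≱ v<hi hi≤v)
  from′ : ¬ v < lo × ¬ (lo < v × v < hi) → lo ≡ v ⊎ hi ≤ v
  from′ (v≮lo , ¬within) with <-cmp v lo | v <? hi
  ... | tri< v<lo _ _ | _        = ⊥-elim (v≮lo v<lo)
  ... | tri≈ _ v≡lo _ | _        = inj₁ (sym v≡lo)
  ... | tri> _ _ lo<v | yes v<hi = ⊥-elim (¬within (lo<v , v<hi))
  ... | tri> _ _ _    | no v≮hi  = inj₂ (≮⇒≥ v≮hi)

-- The shaded boxes are open, so an entry of value lo itself is not excluded; in a
-- permutation that entry is a.
ShadedEmpty : (Fin n → Fin k) → Fin n → ℕ → Fin k → Fin k → Set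
ShadedEmpty f a b lo hi = ∀ m → toℕ m ℕ.< b → m ≢ a → lo ≡ f m ⊎ hi ≤ f m

Occurs : (Fin n → Fin k) → Fin n → Fin n → Fin k → Fin k → Set
Occurs f a b lo hi = lo < hi × ShadedEmpty f a (toℕ b) lo hi

module _ (f : Fin n → Fin k) (a b : Fin n) (lo hi : Fin k) where

  private
    left middle below within : Fin n → Bool
    left m   = toℕ m <ᵇ toℕ a
    middle m = toℕ a <ᵇ toℕ m
    below m  = toℕ (f m) <ᵇ toℕ lo
    within m = (toℕ lo <ᵇ toℕ (f m)) ∧ (toℕ (f m) <ᵇ toℕ hi)

    clear₀₀ clear₀₁ clear₁₀ clear₁₁ : Fin n → Bool
    clear₀₀ m = not (left m ∧ below m)
    clear₀₁ m = not (left m ∧ within m)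
    clear₁₀ m = not (middle m ∧ ((toℕ m <ᵇ toℕ b) ∧ below m))
    clear₁₁ m = not (middle m ∧ ((toℕ m <ᵇ toℕ b) ∧ within m))

  -- Literally the test of the four boxes of R₂ in isOccurrence, for chosen entries a < b
  -- with values lo < hi; T-isOccurrence₁₂ and T-isOccurrence₂₁ rely on this.
  shadingᵇ : Bool
  shadingᵇ = all clear₀₀ (allFin n) ∧ (all clear₀₁ (allFin n)
           ∧ (all clear₁₀ (allFin n) ∧ (all clear₁₁ (allFin n) ∧ true)))

  T-shadingᵇ : a < b → lo ≤ hi → T shadingᵇ ⇔ ShadedEmpty f a (toℕ b) lo hi
  T-shadingᵇ a<b lo≤hi = mk⇔ to′ from′
    where
    T-below : ∀ {m} → T (below m) ⇔ f m < lo
    T-below = T-<ᵇ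
    T-within : ∀ {m} → T (within m) ⇔ (lo < f m × f m < hi)
    T-within {m} = ⇔.trans (T-∧ {toℕ lo <ᵇ toℕ (f m)})
      (mk⇔ (Product.map (to T-<ᵇ) (to T-<ᵇ)) (Product.map (from T-<ᵇ) (from T-<ᵇ)))

    outside : ∀ {m} → ¬ T (below m) → ¬ T (within m) → lo ≡ f m ⊎ hi ≤ f m
    outside ¬below ¬within = from (outside⇔ lo≤hi) (¬below ∘ from T-below , ¬within ∘ from T-within)

    to′ : T shadingᵇ → ShadedEmpty f a (toℕ b) lo hi
    to′ t m m<b m≢a with to (T-∧⁴ {all clear₀₀ (allFin n)}) t | <-cmp m a
    ... | _ | tri≈ _ m≡a _ = ⊥-elim (m≢a m≡a)
    ... | t₀₀ , t₀₁ , _ | tri< m<a _ _ = outside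
      (λ t′ → to T-not (to (T-all-allFin clear₀₀) t₀₀ m) (from T-∧ (<⇒<ᵇ m<a , t′)))
      (λ t′ → to T-not (to (T-all-allFin clear₀₁) t₀₁ m) (from T-∧ (<⇒<ᵇ m<a , t′)))
    ... | _ , _ , t₁₀ , t₁₁ | tri> _ _ a<m = outside
      (λ t′ → to T-not (to (T-all-allFin clear₁₀) t₁₀ m) (from T-∧ (<⇒<ᵇ a<m , from T-∧ (<⇒<ᵇ m<b , t′))))
      (λ t′ → to T-not (to (T-all-allFin clear₁₁) t₁₁ m) (from T-∧ (<⇒<ᵇ a<m , from T-∧ (<⇒<ᵇ m<b , t′))))

    from′ : ShadedEmpty f a (toℕ b) lo hi → T shadingᵇ
    from′ empty = from (T-∧⁴ {all clear₀₀ (allFin n)})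
      ( from (T-all-allFin clear₀₀) (λ m → from T-not λ t →
          let l , v = to (T-∧ {left m}) t in proj₁ (to (outside⇔ lo≤hi) (left-clear l)) (to T-below v))
      , from (T-all-allFin clear₀₁) (λ m → from T-not λ t →
          let l , v = to (T-∧ {left m}) t in proj₂ (to (outside⇔ lo≤hi) (left-clear l)) (to T-within v))
      , from (T-all-allFin clear₁₀) (λ m → from T-not λ t →
          let l , r = to (T-∧ {middle m}) t ; r′ , v = to (T-∧ {toℕ m <ᵇ toℕ b}) r
          in proj₁ (to (outside⇔ lo≤hi) (middle-clear l r′)) (to T-below v))
      , from (T-all-allFin clear₁₁) (λ m → from T-not λ t →
          let l , r = to (T-∧ {middle m}) t ; r′ , v = to (T-∧ {toℕ m <ᵇ toℕ b}) r
          in proj₂ (to (outside⇔ lo≤hi) (middle-clear l r′)) (to T-within v)))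
      where
      left-clear : ∀ {m} → T (left m) → lo ≡ f m ⊎ hi ≤ f m
      left-clear {m} t = empty m (<-trans (<ᵇ⇒< _ _ t) a<b) (<⇒≢ (<ᵇ⇒< _ _ t))
      middle-clear : ∀ {m} → T (middle m) → T (toℕ m <ᵇ toℕ b) → lo ≡ f m ⊎ hi ≤ f m
      middle-clear {m} t t′ = empty m (<ᵇ⇒< _ _ t′) (<⇒≢ (<ᵇ⇒< _ _ t) ∘ sym)

module _ (π : Vec (Fin n) n) {a b : Fin n} (a<b : a < b) where

  private
    x y : ℕ
    x = toℕ (lookup π a)
    y = toℕ (lookup π b)

  -- Once every comparison between x and y is rewritten to a constant, isOccurrence computes.
  T-isOccurrence₁₂ : T (isOccurrence p12 π (a ∷ b ∷ [])) ⇔ Occurs (lookup π) a b (lookup π a) (lookup π b)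
  T-isOccurrence₁₂ with <-cmp (lookup π a) (lookup π b)
  ... | tri< x<y _ y≮x
    rewrite <ᵇ-false (n≮n x) | <ᵇ-false (n≮n y) | <ᵇ-true x<y | <ᵇ-false y≮x | <ᵇ-true (m<n⇒m<1+n x<y)
    = mk⇔ ((x<y ,_) ∘ to shading) (from shading ∘ proj₂)
    where
    shading : T (shadingᵇ (lookup π) a b (lookup π a) (lookup π b))
            ⇔ ShadedEmpty (lookup π) a (toℕ b) (lookup π a) (lookup π b)
    shading = T-shadingᵇ (lookup π) a b (lookup π a) (lookup π b) a<b (<⇒≤ x<y)
  ... | tri≈ x≮y _ _ rewrite <ᵇ-false (n≮n x) | <ᵇ-false x≮y = mk⇔ (λ ()) (x≮y ∘ proj₁)
  ... | tri> x≮y _ _ rewrite <ᵇ-false (n≮n x) | <ᵇ-false x≮y = mk⇔ (λ ()) (x≮y ∘ proj₁)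

  T-isOccurrence₂₁ : T (isOccurrence p21 π (a ∷ b ∷ [])) ⇔ Occurs (lookup π) a b (lookup π b) (lookup π a)
  T-isOccurrence₂₁ with <-cmp (lookup π a) (lookup π b)
  ... | tri> x≮y _ y<x
    rewrite <ᵇ-false (n≮n x) | <ᵇ-false (n≮n y) | <ᵇ-false x≮y | <ᵇ-true y<x | <ᵇ-false {x} {suc y} (<⇒≱ y<x ∘ ℕ.s≤s⁻¹)
    = mk⇔ ((y<x ,_) ∘ to shading) (from shading ∘ proj₂)
    where
    shading : T (shadingᵇ (lookup π) a b (lookup π b) (lookup π a))
            ⇔ ShadedEmpty (lookup π) a (toℕ b) (lookup π b) (lookup π a)
    shading = T-shadingᵇ (lookup π) a b (lookup π b) (lookup π a) a<b (<⇒≤ y<x)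
  ... | tri< x<y _ y≮x rewrite <ᵇ-false (n≮n x) | <ᵇ-true x<y = mk⇔ (λ ()) (y≮x ∘ proj₁)
  ... | tri≈ x≮y _ y≮x rewrite <ᵇ-false (n≮n x) | <ᵇ-false x≮y | <ᵇ-false y≮x = mk⇔ (λ ()) (y≮x ∘ proj₁)

ShadedEmpty-punchIn : (r : Fin (suc k)) (f : Fin n → Fin k) {a : Fin n} {b : ℕ} {lo hi : Fin k} →
  ShadedEmpty (punchIn r ∘ f) a b (punchIn r lo) (punchIn r hi) ⇔ ShadedEmpty f a b lo hi
ShadedEmpty-punchIn r f {lo = lo} {hi} = mk⇔
  (λ empty m m<b m≢a → Sum.map (punchIn-injective r lo (f m)) (punchIn-cancel-≤ r hi (f m)) (empty m m<b m≢a))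
  (λ empty m m<b m≢a → Sum.map (cong (punchIn r)) (punchIn-mono-≤ r hi (f m)) (empty m m<b m≢a))

module _ (σ : Vec (Fin n) n) (r : Fin (suc n)) where

  ShadedEmpty-extend : {a : Fin n} {b : ℕ} {lo hi : Fin (suc n)} → b ℕ.≤ n →
    ShadedEmpty (lookup (extend σ r)) (inject₁ a) b lo hi ⇔ ShadedEmpty (punchIn r ∘ lookup σ) a b lo hi
  ShadedEmpty-extend {a} {b} {lo} {hi} b≤n = mk⇔ to′ from′
    where
    to′ : ShadedEmpty (lookup (extend σ r)) (inject₁ a) b lo hi → ShadedEmpty (punchIn r ∘ lookup σ) a b lo hi
    to′ empty m m<b m≢a rewrite sym (lookup-extend-inject₁ σ r m) =
      empty (inject₁ m) (subst (ℕ._< b) (sym (toℕ-inject₁ m)) m<b) (m≢a ∘ inject₁-injective)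
    from′ : ShadedEmpty (punchIn r ∘ lookup σ) a b lo hi → ShadedEmpty (lookup (extend σ r)) (inject₁ a) b lo hi
    from′ empty m′ m′<b m′≢a with view m′
    ... | ‵fromℕ = ⊥-elim (<⇒≱ (subst (ℕ._< b) (toℕ-fromℕ n) m′<b) b≤n)
    ... | ‵inj₁ {i = m} _ rewrite lookup-extend-inject₁ σ r m =
      empty m (subst (ℕ._< b) (toℕ-inject₁ m) m′<b) (m′≢a ∘ cong inject₁)

  Occurs-extend : {a b c d : Fin n} →
    Occurs (lookup (extend σ r)) (inject₁ a) (inject₁ b)
           (lookup (extend σ r) (inject₁ c)) (lookup (extend σ r) (inject₁ d))
      ⇔ Occurs (lookup σ) a b (lookup σ c) (lookup σ d)
  Occurs-extend {a} {b} {c} {d} rewrite lookup-extend-inject₁ σ r c | lookup-extend-inject₁ σ r d = mk⇔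
    (λ (lo<hi , empty) → punchIn-cancel-< r lo<hi , to shading empty)
    (λ (lo<hi , empty) → punchIn-mono-< r lo<hi , from shading empty)
    where
    shading : ShadedEmpty (lookup (extend σ r)) (inject₁ a) (toℕ (inject₁ b))
                          (punchIn r (lookup σ c)) (punchIn r (lookup σ d))
            ⇔ ShadedEmpty (lookup σ) a (toℕ b) (lookup σ c) (lookup σ d)
    shading rewrite toℕ-inject₁ b = ⇔.trans (ShadedEmpty-extend (<⇒≤ (toℕ<n b))) (ShadedEmpty-punchIn r (lookup σ))

  module _ {a b : Fin n} (a<b : a < b) where

    isOccurrence₁₂-extend :
      isOccurrence p12 (extend σ r) (inject₁ a ∷ inject₁ b ∷ []) ≡ isOccurrence p12 σ (a ∷ b ∷ [])
    isOccurrence₁₂-extend = T-injective (⇔.trans (T-isOccurrence₁₂ (extend σ r) (inject₁-mono-< a<b))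
      (⇔.trans Occurs-extend (⇔.sym (T-isOccurrence₁₂ σ a<b))))

    isOccurrence₂₁-extend :
      isOccurrence p21 (extend σ r) (inject₁ a ∷ inject₁ b ∷ []) ≡ isOccurrence p21 σ (a ∷ b ∷ [])
    isOccurrence₂₁-extend = T-injective (⇔.trans (T-isOccurrence₂₁ (extend σ r) (inject₁-mono-< a<b))
      (⇔.trans Occurs-extend (⇔.sym (T-isOccurrence₂₁ σ a<b))))

module _ (occ : ∀ {n} → Vec (Fin n) n → Vec (Fin n) 2 → Bool)
         (occ-extend : ∀ {n} (σ : Vec (Fin n) n) r {a b : Fin n} → a < b →
                       occ (extend σ r) (inject₁ a ∷ inject₁ b ∷ []) ≡ occ σ (a ∷ b ∷ []))
         where

  count-extend : (σ : Vec (Fin n) n) (r : Fin (suc n)) →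
    length (filterᵇ (occ (extend σ r)) (incTuples (suc n) 2))
      ≡ length (filterᵇ (occ σ) (incTuples n 2)) + countEndingAtLast (occ (extend σ r))
  count-extend {n} σ r = trans (count-incTuples₂-suc (occ (extend σ r)))
    (cong (λ xs → length xs + countEndingAtLast (occ (extend σ r))) (filterᵇ-cong-∈ (incTuples n 2) earlier))
    where
    earlier : ∀ {v} → v ∈ incTuples n 2 → occ (extend σ r) (V.map inject₁ v) ≡ occ σ v
    earlier {a ∷ b ∷ []} v∈ = occ-extend σ r (to ∈-incTuples₂ v∈)

-- Occurrences ending at the appended entry

module _ (σ : Vec (Fin n) n) (σ-perm : IsPermutation σ) (r : Fin (suc n)) (a : Fin n) where

  private
    π′ : Vec (Fin (suc n)) (suc n)
    π′ = extend σ r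

    ShadedEmpty-last : {lo hi : Fin (suc n)} → ShadedEmpty (lookup π′) (inject₁ a) (toℕ (fromℕ n)) lo hi
      ⇔ (∀ m → m ≢ a → lo ≡ punchIn r (lookup σ m) ⊎ hi ≤ punchIn r (lookup σ m))
    ShadedEmpty-last rewrite toℕ-fromℕ n =
      ⇔.trans (ShadedEmpty-extend σ r ≤-refl) (mk⇔ (λ empty m → empty m (toℕ<n m)) (λ empty m _ → empty m))

  T-lastOccurrence₁₂ : T (isOccurrence p12 π′ (pairEndingAtLast a))
    ⇔ (lookup σ a < r × ∀ m → m ≢ a → r ≤ lookup σ m)
  T-lastOccurrence₁₂ = ⇔.trans (T-isOccurrence₁₂ π′ (inject₁<fromℕ a)) occurs
    where
    occurs : Occurs (lookup π′) (inject₁ a) (fromℕ n) (lookup π′ (inject₁ a)) (lookup π′ (fromℕ n))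
      ⇔ (lookup σ a < r × ∀ m → m ≢ a → r ≤ lookup σ m)
    occurs rewrite lookup-extend-inject₁ σ r a | lastValue-extend σ r = mk⇔
      (λ (lo<hi , empty) → to (punchIn<⇔< r (lookup σ a)) lo<hi , λ m m≢a →
        [ (λ e → ⊥-elim (m≢a (σ-perm (punchIn-injective r _ _ (sym e))))) , to (≤punchIn⇔≤ r (lookup σ m)) ]′
        (to ShadedEmpty-last empty m m≢a))
      (λ (σa<r , r≤) → from (punchIn<⇔< r (lookup σ a)) σa<r ,
        from ShadedEmpty-last λ m m≢a → inj₂ (from (≤punchIn⇔≤ r (lookup σ m)) (r≤ m m≢a)))

  T-lastOccurrence₂₁ : T (isOccurrence p21 π′ (pairEndingAtLast a))
    ⇔ (r ≤ lookup σ a × ∀ m → m ≢ a → lookup σ a ≤ lookup σ m)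
  T-lastOccurrence₂₁ = ⇔.trans (T-isOccurrence₂₁ π′ (inject₁<fromℕ a)) occurs
    where
    occurs : Occurs (lookup π′) (inject₁ a) (fromℕ n) (lookup π′ (fromℕ n)) (lookup π′ (inject₁ a))
      ⇔ (r ≤ lookup σ a × ∀ m → m ≢ a → lookup σ a ≤ lookup σ m)
    occurs rewrite lookup-extend-inject₁ σ r a | lastValue-extend σ r = mk⇔
      (λ (lo<hi , empty) → to (<punchIn⇔≤ r (lookup σ a)) lo<hi , λ m m≢a →
        [ (λ e → ⊥-elim (punchInᵢ≢i r (lookup σ m) (sym e))) , punchIn-cancel-≤ r (lookup σ a) (lookup σ m) ]′
        (to ShadedEmpty-last empty m m≢a))
      (λ (r≤σa , minimal) → from (<punchIn⇔≤ r (lookup σ a)) r≤σa ,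
        from ShadedEmpty-last λ m m≢a → inj₂ (punchIn-mono-≤ r (lookup σ a) (lookup σ m) (minimal m m≢a)))

lastCount₁₂ lastCount₂₁ : Fin (suc n) → ℕ
lastCount₁₂ (suc zero)   = 1
lastCount₁₂ _            = 0
lastCount₂₁ {suc n} zero = 1
lastCount₂₁ _            = 0

lastCount₂₁-swap01 : (r : Fin (suc n)) → lastCount₂₁ (swap01 r) ≡ lastCount₁₂ r
lastCount₂₁-swap01 {zero}  zero          = refl
lastCount₂₁-swap01 {suc n} zero          = refl
lastCount₂₁-swap01 {suc n} (suc zero)    = refl
lastCount₂₁-swap01 {suc n} (suc (suc r)) = refl

countEndingAtLast₁₂ : (σ : Vec (Fin n) n) → IsPermutation σ → (r : Fin (suc n)) →
  countEndingAtLast (isOccurrence p12 (extend σ r)) ≡ lastCount₁₂ r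
countEndingAtLast₁₂ {n} σ σ-perm zero = length-filterᵇ-none _ (allFin n) λ a t →
  n≮0 (proj₁ (to (T-lastOccurrence₁₂ σ σ-perm zero a) t))
countEndingAtLast₁₂ {suc n} σ σ-perm (suc zero) = length-filterᵇ-singleton _ (Unique.allFin⁺ _) (∈-allFin a₀)
  (from (T-lastOccurrence₁₂ σ σ-perm (suc zero) a₀) (σa₀<1 , others)) unique
  where
  a₀ : Fin (suc n)
  a₀ = preimage σ-perm zero
  σa₀<1 : toℕ (lookup σ a₀) ℕ.< 1
  σa₀<1 = subst (λ v → toℕ v ℕ.< 1) (sym (preimage-correct σ-perm zero)) (s≤s z≤n)
  others : ∀ m → m ≢ a₀ → 1 ℕ.≤ toℕ (lookup σ m)
  others m m≢a₀ = n≢0⇒n>0 λ σm≡0 → m≢a₀ (σ-perm (trans (toℕ-injective σm≡0) (sym (preimage-correct σ-perm zero))))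
  unique : ∀ {a} → T (isOccurrence p12 (extend σ (suc zero)) (pairEndingAtLast a)) → a ≡ a₀
  unique {a} t = σ-perm (trans (toℕ-injective (n<1⇒n≡0 (proj₁ (to (T-lastOccurrence₁₂ σ σ-perm (suc zero) a) t))))
                               (sym (preimage-correct σ-perm zero)))
countEndingAtLast₁₂ {suc (suc n)} σ σ-perm (suc (suc r)) = length-filterᵇ-none _ (allFin _) λ a t →
  let _ , r≤ = to (T-lastOccurrence₁₂ σ σ-perm (suc (suc r)) a) t
      m , m≢a , σm≤1 = small a
  in <⇒≱ (s≤s (s≤s z≤n)) (≤-trans (r≤ m m≢a) σm≤1)
  where
  a₀ a₁ : Fin (suc (suc n))
  a₀ = preimage σ-perm zero
  a₁ = preimage σ-perm (suc zero)
  a₁≢a₀ : a₁ ≢ a₀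
  a₁≢a₀ a₁≡a₀ with () ← trans (sym (preimage-correct σ-perm (suc zero)))
                             (trans (cong (lookup σ) a₁≡a₀) (preimage-correct σ-perm zero))
  small : ∀ a → ∃ λ m → m ≢ a × toℕ (lookup σ m) ℕ.≤ 1
  small a with a₀ ≟ a
  ... | no a₀≢a  = a₀ , a₀≢a , subst (λ v → toℕ v ℕ.≤ 1) (sym (preimage-correct σ-perm zero)) z≤n
  ... | yes refl = a₁ , a₁≢a₀ , subst (λ v → toℕ v ℕ.≤ 1) (sym (preimage-correct σ-perm (suc zero))) (s≤s z≤n)

countEndingAtLast₂₁ : (σ : Vec (Fin n) n) → IsPermutation σ → (r : Fin (suc n)) →
  countEndingAtLast (isOccurrence p21 (extend σ r)) ≡ lastCount₂₁ r
countEndingAtLast₂₁ {zero}  σ σ-perm r    = refl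
countEndingAtLast₂₁ {suc n} σ σ-perm zero = length-filterᵇ-singleton _ (Unique.allFin⁺ _) (∈-allFin a₀)
  (from (T-lastOccurrence₂₁ σ σ-perm zero a₀) (z≤n , a₀-minimal)) unique
  where
  a₀ : Fin (suc n)
  a₀ = preimage σ-perm zero
  a₀-minimal : ∀ m → m ≢ a₀ → lookup σ a₀ ≤ lookup σ m
  a₀-minimal m _ = subst (λ v → toℕ v ℕ.≤ toℕ (lookup σ m)) (sym (preimage-correct σ-perm zero)) z≤n
  unique : ∀ {a} → T (isOccurrence p21 (extend σ zero) (pairEndingAtLast a)) → a ≡ a₀
  unique {a} t = σ-perm (trans (minimal⇒zero σ-perm a (proj₂ (to (T-lastOccurrence₂₁ σ σ-perm zero a) t)))
                               (sym (preimage-correct σ-perm zero)))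
countEndingAtLast₂₁ {suc n} σ σ-perm (suc r) = length-filterᵇ-none _ (allFin _) λ a t →
  let r<σa , minimal = to (T-lastOccurrence₂₁ σ σ-perm (suc r) a) t
  in n≮0 (subst (λ v → toℕ r ℕ.< toℕ v) (minimal⇒zero σ-perm a minimal) r<σa)

occurrences-rankSwap : (π : Vec (Fin n) n) → IsPermutation π → occurrences p21 (rankSwap π) ≡ occurrences p12 π
occurrences-rankSwap {zero}  [] _      = refl
occurrences-rankSwap {suc n} π  π-perm = begin
  occurrences p21 (extend (rankSwap σ) (swap01 r))
    ≡⟨ count-extend (isOccurrence p21) isOccurrence₂₁-extend (rankSwap σ) (swap01 r) ⟩
  occurrences p21 (rankSwap σ) + countEndingAtLast (isOccurrence p21 (extend (rankSwap σ) (swap01 r)))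
    ≡⟨ cong₂ _+_ (occurrences-rankSwap σ σ-perm)
                 (trans (countEndingAtLast₂₁ (rankSwap σ) (rankSwap-isPermutation σ σ-perm) (swap01 r))
                        (lastCount₂₁-swap01 r)) ⟩
  occurrences p12 σ + lastCount₁₂ r
    ≡⟨ cong (occurrences p12 σ +_) (countEndingAtLast₁₂ σ σ-perm r) ⟨
  occurrences p12 σ + countEndingAtLast (isOccurrence p12 (extend σ r))
    ≡⟨ count-extend (isOccurrence p12) isOccurrence₁₂-extend σ r ⟨
  occurrences p12 (extend σ r)
    ≡⟨ cong (occurrences p12) (extend-restrict π-perm) ⟩
  occurrences p12 π ∎
  where
  open ≡-Reasoning
  σ : Vec (Fin n) n
  σ = restrict π
  r : Fin (suc n)
  r = lastValue π
  σ-perm : IsPermutation σ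
  σ-perm = restrict-isPermutation π π-perm

theorem2p4 : p12 ∼d p21
theorem2p4 n ℓ = length-filterᵇ-involution {f = rankSwap} (perms-unique n)
  (λ {π} → from ∈-perms ∘ rankSwap-isPermutation π ∘ to ∈-perms)
  (rankSwap-involutive ∘ to ∈-perms)
  (λ π → occurrences p12 π ≡ᵇ ℓ) (λ π → occurrences p21 π ≡ᵇ ℓ)
  (λ {π} π∈ → cong (_≡ᵇ ℓ) (occurrences-rankSwap π (to ∈-perms π∈)))
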